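{- Let $\mathcal{F}$ be a non-principal filter on $\mathbb{N}=\{1,2,3,\dots\}$. The following are equivalent: (1) $\mathcal{F}$ is a meager filter; (2) player ONE has a winning strategy in the game $\mathfrak{G}_1(\mathcal{F})$; (3) the game $\mathfrak{G}_1(\mathcal{F})$ is determined.
   Context: A non-principal filter on $\mathbb{N}$ is a proper filter $\mathcal{F}\subseteq\mathcal{P}(\mathbb{N})$ containing no finite set. $\mathcal{F}$ is meager if it is a meager subset of $\mathcal{P}(\mathbb{N})$, identified with the Cantor space $\{0,1\}^{\mathbb{N}}$ via characteristic functions. The game $\mathfrak{G}_1(\mathcal{F})$: in the $k$-th inning ($k=1,2,\dots$), player ONE chooses $m_k\in\mathbb{N}$ and then player TWO responds with $n_k\in\mathbb{N}$. TWO wins the play $(m_1,n_1,m_2,n_2,\dots)$ if (i) $n_1<n_2<\dots$, (ii) there are infinitely many $k$ with $m_k<n_k$, and (iii) $\{n_1,n_2,\dots\}\in\mathcal{F}$; otherwise ONE wins. A strategy for a player assigns a move to each finite sequence of the opponent's previous moves; it is winning if every play following it is won by that player. The game is determined if one of the two players has a winning strategy. -}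

module Defs where

open import Data.Nat using (ℕ; zero; suc; _<_; _≤_; _≡ᵇ_)
open import Data.Bool using (Bool; true; false; _∧_; _∨_)
open import Data.List using (List; []; _∷_; _++_; map; upTo)
open import Data.Bool.ListAction using (any)
open import Data.Product using (Σ; ∃; _×_; _,_)
open import Data.Sum using (_⊎_)
open import Data.Unit using (⊤)
open import Relation.Nullary using (¬_)
open import Relation.Binary.PropositionalEquality using (_≡_)
open import Function using (_∘_)

-- Subsets of ℕ = points of the Cantor space {0,1}^ℕ (characteristic functions).
-- (ℕ here starts at 0; the shift n ↦ n+1 is an order isomorphism.)
Subset : Set
Subset = ℕ → Bool

_⊆_ : Subset → Subset → Set
A ⊆ B = ∀ n → A n ≡ true → B n ≡ true

_∩_ : Subset → Subset → Subset
(A ∩ B) n = A n ∧ B n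

Finite : Subset → Set
Finite A = Σ ℕ λ N → ∀ n → A n ≡ true → n < N

Family : Set₁
Family = Subset → Set

record IsFilter (F : Family) : Set where
  field
    upward  : ∀ A B → A ⊆ B → F A → F B
    inter   : ∀ A B → F A → F B → F (A ∩ B)
    full    : F (λ _ → true)
    proper  : ¬ F (λ _ → false)

NonPrincipal : Family → Set
NonPrincipal F = ∀ A → Finite A → ¬ F A

Extends : List Bool → Subset → Set
Extends []      x = ⊤
Extends (b ∷ s) x = (x 0 ≡ b) × Extends s (x ∘ suc)

NowhereDense : Family → Set
NowhereDense X = ∀ s → Σ (List Bool) λ t → ∀ x → Extends (s ++ t) x → ¬ X x

Meager : Family → Set₁
Meager X = Σ (ℕ → Family) λ D →
  (∀ k → NowhereDense (D k)) × (∀ x → X x → Σ ℕ λ k → D k x)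

-- The game G₁(F).  Innings are indexed k = 0,1,2,…; m k is ONE's move,
-- n k is TWO's move in inning k.

firstN : (ℕ → ℕ) → ℕ → List ℕ
firstN f k = map f (upTo k)

-- range of a sequence as a characteristic function; for a strictly
-- increasing n (so n k ≥ k) this is exactly {n 0, n 1, …}.
rangeInc : (ℕ → ℕ) → Subset
rangeInc n j = any (λ k → n k ≡ᵇ j) (upTo (suc j))

TwoWinsPlay : Family → (ℕ → ℕ) → (ℕ → ℕ) → Set
TwoWinsPlay F m n =
  (∀ k → n k < n (suc k)) ×
  (∀ K → Σ ℕ λ k → K ≤ k × m k < n k) ×
  F (rangeInc n)

-- ONE's strategy: TWO's previous moves ↦ ONE's next move.
-- A play following σ is determined by TWO's moves n.
OneHasWinningStrategy : Family → Set
OneHasWinningStrategy F =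
  Σ (List ℕ → ℕ) λ σ → ∀ (n : ℕ → ℕ) → ¬ TwoWinsPlay F (λ k → σ (firstN n k)) n

-- TWO's strategy: ONE's moves so far (m_1..m_k) ↦ TWO's k-th move.
TwoHasWinningStrategy : Family → Set
TwoHasWinningStrategy F =
  Σ (List ℕ → ℕ) λ τ → ∀ (m : ℕ → ℕ) → TwoWinsPlay F m (λ k → τ (firstN m (suc k)))

Determined : Family → Set
Determined F = OneHasWinningStrategy F ⊎ TwoHasWinningStrategy F

{-# OPTIONS --safe #-}
module Submission where

-- A filter F is meager iff there are intervals [e j, e (j+1)) such that every member of F meets
-- all but finitely many of them (Talagrand).  Given such intervals, ONE wins by demanding that
-- TWO's next move lie beyond a whole interval situated above TWO's previous moves: the range of
-- a play won by TWO would be a member of F missing infinitely many intervals.  Conversely, if σ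
-- wins for ONE, take intervals so long that σ answers every history below an interval before
-- the interval ends; a member of F missing infinitely many intervals, enumerated increasingly,
-- is then a play of TWO beating σ.  A meager filter also yields such intervals: let interval j
-- start with a string that, after any prefix, leaves the first e j nowhere dense sets of the
-- cover; writing these strings into the intervals missed by a member of F produces a member of F
-- outside the whole cover.  Finally TWO never wins: against a strategy τ of TWO, ONE runs two
-- plays, each time answering with TWO's latest move in the other play, always from positions
-- where τ must answer above ONE's move (these exist, for otherwise ONE could keep TWO's moves
-- below his own forever).  The two ranges interleave, so their intersection is a finite member
-- of F.

open import Defs
open import Level using (0ℓ)
open import Data.Product using (_×_)
open import Function.Bundles using (_⇔_; mk⇔; Equivalence)
open import Axiom.ExcludedMiddle using (ExcludedMiddle)

open import Data.Bool using (Bool; true; false; _∨_)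
open import Data.Bool.Properties using (T-≡; ¬-not; ∧-conicalˡ; ∧-conicalʳ)
open import Data.Empty using (⊥; ⊥-elim)
open import Data.List using (List; []; _∷_; _++_; _∷ʳ_; map; upTo; applyUpTo; length; replicate)
open import Data.List.Extrema.Nat using (max; xs≤max)
open import Data.List.Membership.Propositional using (_∈_)
open import Data.List.Membership.Propositional.Properties using (∈-map⁺; ∈-upTo⁺; ∈-++⁺ˡ; ∈-++⁺ʳ)
open import Data.List.Properties
  using (map-upTo; length-applyUpTo; length-map; length-++; applyUpTo-∷ʳ; ∷ʳ-++; ++-assoc; ++-identityʳ)
import Data.List.Relation.Unary.All as All
open import Data.List.Relation.Unary.Any using (here; there)
import Data.List.Relation.Unary.Any.Properties as Any
open import Data.Nat
open import Data.Nat.Properties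
open import Data.Product using (Σ; _,_; proj₁; proj₂)
open import Data.Sum using (_⊎_; inj₁; inj₂; [_,_])
open import Data.Unit using (tt)
open import Function using (_∘_; id)
open import Relation.Binary.Definitions using (tri<; tri≈; tri>)
open import Relation.Binary.PropositionalEquality hiding ([_])
open import Relation.Nullary using (¬_; yes; no; contradiction)

nth : {A : Set} → A → List A → ℕ → A
nth d []       _       = d
nth d (x ∷ xs) zero    = x
nth d (x ∷ xs) (suc i) = nth d xs i

nth-++-length : ∀ {A : Set} {d : A} p x r → nth d (p ++ x ∷ r) (length p) ≡ x
nth-++-length []      x r = refl
nth-++-length (y ∷ p) x r = nth-++-length p x r

applyUpTo-nth : {A : Set} (d : A) (xs : List A) → applyUpTo (nth d xs) (length xs) ≡ xs
applyUpTo-nth d []       = refl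
applyUpTo-nth d (x ∷ xs) = cong (x ∷_) (applyUpTo-nth d xs)

applyUpTo-cong : {A : Set} {f g : ℕ → A} → ∀ n → (∀ {k} → k < n → f k ≡ g k) →
                 applyUpTo f n ≡ applyUpTo g n
applyUpTo-cong zero    f≗g = refl
applyUpTo-cong (suc n) f≗g = cong₂ _∷_ (f≗g z<s) (applyUpTo-cong n (f≗g ∘ s<s))

length-firstN : ∀ f k → length (firstN f k) ≡ k
length-firstN f k = trans (length-map f (upTo k)) (length-applyUpTo id k)

_⊑_ : List ℕ → List ℕ → Set
p ⊑ q = Σ (List ℕ) λ r → p ++ r ≡ q

⊑-refl : ∀ p → p ⊑ p
⊑-refl p = [] , ++-identityʳ p

⊑-trans : ∀ {p q s} → p ⊑ q → q ⊑ s → p ⊑ s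
⊑-trans {p} (r , refl) (r′ , refl) = r ++ r′ , sym (++-assoc p r r′)

⊑-chain : ∀ {P : ℕ → List ℕ} → (∀ i → P i ⊑ P (suc i)) → ∀ {i j} → i ≤ j → P i ⊑ P j
⊑-chain {P} step {i} i≤j with m≤n⇒m<n∨m≡n i≤j
... | inj₂ refl = ⊑-refl (P i)
⊑-chain step {j = suc j} _ | inj₁ (s≤s i≤j) = ⊑-trans (⊑-chain step i≤j) (step j)

nth-⊑ : ∀ {d k : ℕ} {p q} → p ⊑ q → k < length p → nth d q k ≡ nth d p k
nth-⊑ {k = zero}  {x ∷ p} (r , refl) _         = refl
nth-⊑ {k = suc k} {x ∷ p} (r , refl) (s<s k<p) = nth-⊑ {p = p} (r , refl) k<p

firstN-nth : ∀ {d p q} → p ⊑ q → firstN (nth d q) (length p) ≡ p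
firstN-nth {d} {p} {q} p⊑q = begin
  firstN (nth d q) (length p)    ≡⟨ map-upTo (nth d q) (length p) ⟩
  applyUpTo (nth d q) (length p) ≡⟨ applyUpTo-cong (length p) (nth-⊑ p⊑q) ⟩
  applyUpTo (nth d p) (length p) ≡⟨ applyUpTo-nth d p ⟩
  p                              ∎
  where open ≡-Reasoning

firstN-suc : ∀ f k → firstN f (suc k) ≡ firstN f k ∷ʳ f k
firstN-suc f k rewrite map-upTo f k | map-upTo f (suc k) = sym (applyUpTo-∷ʳ f k)

firstN-⊑ : ∀ f {a b} → a ≤ b → firstN f a ⊑ firstN f b
firstN-⊑ f = ⊑-chain λ k → f k ∷ [] , sym (firstN-suc f k)

Increasing : (ℕ → ℕ) → Set
Increasing f = ∀ k → f k < f (suc k)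

module _ {f : ℕ → ℕ} (inc : Increasing f) where

  increasing-< : ∀ {i j} → i < j → f i < f j
  increasing-< {i} {suc j} (s≤s i≤j) with m≤n⇒m<n∨m≡n i≤j
  ... | inj₁ i<j  = <-trans (increasing-< i<j) (inc j)
  ... | inj₂ refl = inc i

  increasing-≤ : ∀ {i j} → i ≤ j → f i ≤ f j
  increasing-≤ i≤j with m≤n⇒m<n∨m≡n i≤j
  ... | inj₁ i<j  = <⇒≤ (increasing-< i<j)
  ... | inj₂ refl = ≤-refl

  increasing-inflationary : ∀ k → k ≤ f k
  increasing-inflationary zero    = z≤n
  increasing-inflationary (suc k) = ≤-trans (s≤s (increasing-inflationary k)) (inc k)

  straddle : ∀ {K b} → f K < b → Σ ℕ λ k → K ≤ k × f k < b × b ≤ f (suc k)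
  straddle {K} {b} fK<b = go b (≤-trans (m≤m+n b K) (increasing-inflationary (b + K)))
    where
    go : ∀ d → b ≤ f (d + K) → Σ ℕ λ k → K ≤ k × f k < b × b ≤ f (suc k)
    go zero    b≤fK = contradiction b≤fK (<⇒≱ fK<b)
    go (suc d) b≤f with b ≤? f (d + K)
    ... | yes b≤f′ = go d b≤f′
    ... | no  b≰f′ = d + K , m≤n+m K d , ≰⇒> b≰f′ , b≤f

rangeInc-sound : ∀ n {j} → rangeInc n j ≡ true → Σ ℕ λ k → n k ≡ j
rangeInc-sound n {j} j∈ with Any.applyUpTo⁻ id (Any.any⁻ _ (upTo (suc j)) (Equivalence.from T-≡ j∈))
... | k , _ , nk≡ᵇj = k , ≡ᵇ⇒≡ (n k) j nk≡ᵇj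

rangeInc-complete : ∀ {n} → Increasing n → ∀ k → rangeInc n (n k) ≡ true
rangeInc-complete {n} inc k = Equivalence.to T-≡
  (Any.any⁺ _ (Any.applyUpTo⁺ id (≡⇒≡ᵇ (n k) (n k) refl) (s≤s (increasing-inflationary inc k))))

record LeastAbove (x : Subset) (a : ℕ) : Set where
  constructor leastAt
  field
    least  : ℕ
    above  : a ≤ least
    member : x least ≡ true
    gap    : ∀ i → a ≤ i → i < least → x i ≡ false

leastAbove : ∀ x a d → x (a + d) ≡ true → LeastAbove x a
leastAbove x a d x[a+d] with x a in xa
... | true = leastAt a ≤-refl xa λ i a≤i i<a → contradiction a≤i (<⇒≱ i<a)
leastAbove x a zero    x[a+0] | false =
  contradiction (trans (sym xa) (subst (λ i → x i ≡ true) (+-identityʳ a) x[a+0])) λ ()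
leastAbove x a (suc d) x[a+d] | false
  with leastAt c a<c xc gap ← leastAbove x (suc a) d (subst (λ i → x i ≡ true) (+-suc a d) x[a+d])
  = leastAt c (<⇒≤ a<c) xc gap′
  where
  gap′ : ∀ i → a ≤ i → i < c → x i ≡ false
  gap′ i a≤i i<c with m≤n⇒m<n∨m≡n a≤i
  ... | inj₁ a<i  = gap i a<i i<c
  ... | inj₂ refl = xa

record Enumeration (x : Subset) : Set where
  field
    n          : ℕ → ℕ
    increasing : Increasing n
    n∈x        : ∀ k → x (n k) ≡ true
    complete   : x ⊆ rangeInc n

-- Opaque: only the fields of an enumeration matter, and unfolding its construction makes
-- with-abstractions over them very slow to check.
opaque
  enumerate : ExcludedMiddle 0ℓ → ∀ x → ¬ Finite x → Enumeration x
  enumerate lem x infinite = record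
    { n          = n
    ; increasing = increasing
    ; n∈x        = λ k → LeastAbove.member (next (from k))
    ; complete   = complete
    }
    where
    unbounded : ∀ a → Σ ℕ λ b → a ≤ b × x b ≡ true
    unbounded a with lem {Σ ℕ λ b → a ≤ b × x b ≡ true}
    ... | yes above = above
    ... | no  ¬above = ⊥-elim (infinite (a , λ b xb → ≰⇒> λ a≤b → ¬above (b , a≤b , xb)))

    next : ∀ a → LeastAbove x a
    next a with b , a≤b , xb ← unbounded a =
      leastAbove x a (b ∸ a) (subst (λ i → x i ≡ true) (sym (m+[n∸m]≡n a≤b)) xb)

    mutual
      from : ℕ → ℕ
      from zero    = 0
      from (suc k) = suc (n k)

      n : ℕ → ℕ
      n k = LeastAbove.least (next (from k))

    increasing : Increasing n
    increasing k = LeastAbove.above (next (from (suc k)))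

    nothing-between : ∀ k i → from k ≤ i → i < n k → x i ≡ false
    nothing-between k = LeastAbove.gap (next (from k))

    complete : x ⊆ rangeInc n
    complete i xi with i <? n 0
    ... | yes i<n₀ = contradiction (trans (sym xi) (nothing-between 0 i z≤n i<n₀)) λ ()
    ... | no  i≮n₀ = between (straddle increasing {0} (s≤s (≮⇒≥ i≮n₀)))
      where
      between : (Σ ℕ λ k → 0 ≤ k × n k < suc i × suc i ≤ n (suc k)) → rangeInc n i ≡ true
      between (k , _ , s≤s nk≤i , i<nk₁) =
        [ (λ nk<i → contradiction (trans (sym xi) (nothing-between (suc k) i nk<i i<nk₁)) λ ())
        , (λ nk≡i → subst (λ j → rangeInc n j ≡ true) nk≡i (rangeInc-complete increasing k))
        ] (m≤n⇒m<n∨m≡n nk≤i)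

partitionBy : (ℕ → ℕ) → ℕ → ℕ
partitionBy g zero    = 0
partitionBy g (suc j) = suc (partitionBy g j + g (partitionBy g j))

partitionBy-increasing : ∀ g → Increasing (partitionBy g)
partitionBy-increasing g j = s≤s (m≤m+n _ _)

locate : ∀ g i → Σ ℕ λ j → partitionBy g j ≤ i × i < partitionBy g (suc j)
locate g zero    = 0 , z≤n , z<s
locate g (suc i) with j , pj≤i , i<pj₁ ← locate g i with suc i <? partitionBy g (suc j)
... | yes 1+i<pj₁ = j , m≤n⇒m≤1+n pj≤i , 1+i<pj₁
... | no  1+i≮pj₁ = suc j , ≮⇒≥ 1+i≮pj₁ , ≤-<-trans i<pj₁ (partitionBy-increasing g (suc j))

interval-unique : ∀ {e} → Increasing e → ∀ {i j j′} → e j ≤ i → i < e (suc j) →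
                  e j′ ≤ i → i < e (suc j′) → j ≡ j′
interval-unique inc {i} {j} {j′} ej≤i i<ej₁ ej′≤i i<ej′₁ with <-cmp j j′
... | tri< j<j′ _ _ = contradiction (≤-trans (increasing-≤ inc j<j′) ej′≤i) (<⇒≱ i<ej₁)
... | tri≈ _ j≡j′ _ = j≡j′
... | tri> _ _ j′<j = contradiction (≤-trans (increasing-≤ inc j′<j) ej≤i) (<⇒≱ i<ej′₁)

Misses : (ℕ → ℕ) → Subset → ℕ → Set
Misses e A j = ∀ i → e j ≤ i → i < e (suc j) → A i ≡ false

MissesInfinitelyMany : (ℕ → ℕ) → Subset → Set
MissesInfinitelyMany e A = ∀ J → Σ ℕ λ j → J ≤ j × Misses e A j

-- Classically, `meets` says that every member of F meets all but finitely many of the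
-- intervals [e j, e (suc j)).
record TalagrandPartition (F : Family) : Set where
  field
    e          : ℕ → ℕ
    increasing : Increasing e
    meets      : ∀ A → F A → ¬ MissesInfinitelyMany e A

Extends-++⁻ˡ : ∀ p q x → Extends (p ++ q) x → Extends p x
Extends-++⁻ˡ []      q x _          = tt
Extends-++⁻ˡ (b ∷ p) q x (x₀ , xpq) = x₀ , Extends-++⁻ˡ p q (x ∘ suc) xpq

Extends-++⁻ʳ : ∀ p q x → Extends (p ++ q) x → Extends q (λ d → x (length p + d))
Extends-++⁻ʳ []      q x xq         = xq
Extends-++⁻ʳ (b ∷ p) q x (_ , xpq) = Extends-++⁻ʳ p q (x ∘ suc) xpq

Extends-replicate : ∀ {N b d} x → Extends (replicate N b) x → d < N → x d ≡ b
Extends-replicate {d = zero}  x (x₀ , _)  z<s       = x₀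
Extends-replicate {d = suc d} x (_ , xbs) (s<s d<N) = Extends-replicate (x ∘ suc) xbs d<N

Extends-applyUpTo-++ : ∀ x n w → (∀ {d} → d < length w → x (n + d) ≡ nth false w d) →
                       Extends (applyUpTo x n ++ w) x
Extends-applyUpTo-++ x zero    []      x≗w = tt
Extends-applyUpTo-++ x zero    (b ∷ w) x≗w = x≗w z<s , Extends-applyUpTo-++ (x ∘ suc) zero w (x≗w ∘ s<s)
Extends-applyUpTo-++ x (suc n) w       x≗w = refl , Extends-applyUpTo-++ (x ∘ suc) n w x≗w

Avoids : Family → List Bool → List Bool → Set
Avoids X s t = ∀ x → Extends (s ++ t) x → ¬ X x

avoids-assoc : ∀ {X} s t u → Avoids X (s ++ t) u → Avoids X s (t ++ u)
avoids-assoc s t u avoid x = avoid x ∘ subst (λ w → Extends w x) (sym (++-assoc s t u))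

avoids-++ : ∀ {X} s t u → Avoids X s t → Avoids X s (t ++ u)
avoids-++ s t u avoid x =
  avoid x ∘ Extends-++⁻ˡ (s ++ t) u x ∘ subst (λ w → Extends w x) (sym (++-assoc s t u))

nowhereDense-⊆ : ∀ {X Y} → (∀ x → X x → Y x) → NowhereDense Y → NowhereDense X
nowhereDense-⊆ X⊆Y ndY s = proj₁ (ndY s) , λ x ext → proj₂ (ndY s) x ext ∘ X⊆Y x

nowhereDense-∪ : ∀ {X Y} → NowhereDense X → NowhereDense Y → NowhereDense (λ x → X x ⊎ Y x)
nowhereDense-∪ ndX ndY s with t , avoidX ← ndX s with u , avoidY ← ndY (s ++ t) =
  t ++ u , λ x ext → [ avoids-++ s t u avoidX x ext , avoids-assoc s t u avoidY x ext ]

strings : ℕ → List (List Bool)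
strings zero    = [] ∷ []
strings (suc a) = map (true ∷_) (strings a) ++ map (false ∷_) (strings a)

∈-strings : ∀ s → s ∈ strings (length s)
∈-strings []          = here refl
∈-strings (true ∷ s)  = ∈-++⁺ˡ (∈-map⁺ (true ∷_) (∈-strings s))
∈-strings (false ∷ s) = ∈-++⁺ʳ _ (∈-map⁺ (false ∷_) (∈-strings s))

avoidsAll : ∀ {X} → NowhereDense X → ∀ ss → Σ (List Bool) λ t → ∀ {s} → s ∈ ss → Avoids X s t
avoidsAll nd []       = [] , λ ()
avoidsAll nd (s ∷ ss) with t , avoid ← avoidsAll nd ss with u , avoidₛ ← nd (s ++ t) = t ++ u , λ where
  (here refl) → avoids-assoc s t u avoidₛ
  (there s∈)  → avoids-++ _ t u (avoid s∈)

uniformlyAvoiding : ∀ {X} → NowhereDense X → ℕ → List Bool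
uniformlyAvoiding nd a = proj₁ (avoidsAll nd (strings a))

uniformlyAvoiding-avoids : ∀ {X} (nd : NowhereDense X) {a} s → length s ≡ a →
                           Avoids X s (uniformlyAvoiding nd a)
uniformlyAvoiding-avoids nd s refl = proj₂ (avoidsAll nd (strings (length s))) (∈-strings s)

-- From a meager filter to a Talagrand partition

module FromMeager {F : Family} (filter : IsFilter F) (D : ℕ → Family)
                  (nowhereDense : ∀ K → NowhereDense (D K)) (covers : ∀ x → F x → Σ ℕ λ K → D K x) where

  Below : ℕ → Family
  Below a x = Σ ℕ λ K → K < a × D K x

  below-nowhereDense : ∀ a → NowhereDense (Below a)
  below-nowhereDense zero    s = [] , λ { x _ (_ , () , _) }
  below-nowhereDense (suc a) = nowhereDense-⊆ split (nowhereDense-∪ (below-nowhereDense a) (nowhereDense a))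
    where
    split : ∀ x → Below (suc a) x → Below a x ⊎ D a x
    split x (K , K<1+a , DKx) with m<1+n⇒m<n∨m≡n K<1+a
    ... | inj₁ K<a  = inj₁ (K , K<a , DKx)
    ... | inj₂ refl = inj₂ DKx

  W : ℕ → List Bool
  W a = uniformlyAvoiding (below-nowhereDense a) a

  e : ℕ → ℕ
  e = partitionBy (length ∘ W)

  inside : ∀ j {d} → d < length (W (e j)) → e j + d < e (suc j)
  inside j d<w = s≤s (+-monoʳ-≤ (e j) (<⇒≤ d<w))

  fill : Subset
  fill i with j , _ ← locate (length ∘ W) i = nth false (W (e j)) (i ∸ e j)

  fill-interval : ∀ j {d} → d < length (W (e j)) → fill (e j + d) ≡ nth false (W (e j)) d
  fill-interval j {d} d<w with locate (length ∘ W) (e j + d)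
  ... | j′ , ej′≤i , i<ej′₁
    rewrite interval-unique (partitionBy-increasing _) ej′≤i i<ej′₁ (m≤m+n (e j) d) (inside j d<w)
    = cong (nth false (W (e j))) (m+n∸m≡n (e j) d)

  -- A ∪ fill is in F and agrees with W (e j) on every interval j missed by A, so it avoids
  -- Below (e j) for infinitely many j, i.e. it avoids every D K.
  meets : ∀ A → F A → ¬ MissesInfinitelyMany e A
  meets A A∈F missesInf = outsideCover (covers Y Y∈F)
    where
    Y : Subset
    Y i = A i ∨ fill i

    Y∈F : F Y
    Y∈F = IsFilter.upward filter A Y (λ i Ai → cong (_∨ fill i) Ai) A∈F

    outsideCover : ¬ (Σ ℕ λ K → D K Y)
    outsideCover (K , DKY) with j , K<j , misses ← missesInf (suc K) =
      uniformlyAvoiding-avoids (below-nowhereDense (e j)) (applyUpTo Y (e j)) (length-applyUpTo Y (e j))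
        Y (Extends-applyUpTo-++ Y (e j) (W (e j)) Y-interval)
        (K , <-≤-trans K<j (increasing-inflationary (partitionBy-increasing _) j) , DKY)
      where
      Y-interval : ∀ {d} → d < length (W (e j)) → Y (e j + d) ≡ nth false (W (e j)) d
      Y-interval {d} d<w rewrite misses (e j + d) (m≤m+n (e j) d) (inside j d<w) = fill-interval j d<w

talagrand-if-meager : ∀ {F} → IsFilter F → Meager F → TalagrandPartition F
talagrand-if-meager filter (D , nowhereDense , covers) = record
  { e          = e
  ; increasing = partitionBy-increasing _
  ; meets      = meets
  }
  where open FromMeager filter D nowhereDense covers

-- From a Talagrand partition to a winning strategy for ONE

oneWins-if-talagrand : ∀ {F} → TalagrandPartition F → OneHasWinningStrategy F
oneWins-if-talagrand P = σ , λ n (inc , infinitelyAbove , range∈F) →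
    meets (rangeInc n) range∈F (missed n inc infinitelyAbove)
  where
  open TalagrandPartition P

  -- Interval gapIndex l lies above every entry of l and ends at σ l, so a move of TWO
  -- beyond σ l jumps over the whole interval.
  gapIndex : List ℕ → ℕ
  gapIndex l = suc (length l + max 0 l)

  σ : List ℕ → ℕ
  σ l = e (suc (gapIndex l))

  missed : ∀ n → Increasing n → (∀ K → Σ ℕ λ k → K ≤ k × σ (firstN n k) < n k) →
           MissesInfinitelyMany e (rangeInc n)
  missed n inc infinitelyAbove J with k , J≤k , σ<nk ← infinitelyAbove J = gapIndex l , J≤j , misses
    where
    l = firstN n k
    J≤j : J ≤ gapIndex l
    J≤j = m≤n⇒m≤1+n (≤-trans J≤k (subst (_≤ length l + max 0 l) (length-firstN n k) (m≤m+n _ _)))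
    misses : Misses e (rangeInc n) (gapIndex l)
    misses i ej≤i i<ej₁ = ¬-not λ i∈range → notInRange (rangeInc-sound n i∈range)
      where
      notInRange : ¬ (Σ ℕ λ k′ → n k′ ≡ i)
      notInRange (k′ , refl) with k′ <? k
      ... | yes k′<k =
        <⇒≱ (<-≤-trans (s≤s (m≤n+m _ _)) (≤-trans (increasing-inflationary increasing _) ej≤i))
            (All.lookup (xs≤max 0 l) (∈-map⁺ n (∈-upTo⁺ k′<k)))
      ... | no  k′≮k = <⇒≱ (<-trans i<ej₁ σ<nk) (increasing-≤ inc (≮⇒≥ k′≮k))

-- From a winning strategy for ONE to a Talagrand partition

increasingLists : ℕ → List (List ℕ)
increasingLists zero    = [] ∷ []
increasingLists (suc N) = increasingLists N ++ map (_∷ʳ N) (increasingLists N)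

increasingLists-⊆ : ∀ {N N′} → N ≤ N′ → ∀ {l} → l ∈ increasingLists N → l ∈ increasingLists N′
increasingLists-⊆ {N′ = zero}   z≤n = id
increasingLists-⊆ {N′ = suc N′} N≤1+N′ with m≤n⇒m<n∨m≡n N≤1+N′
... | inj₁ (s≤s N≤N′) = ∈-++⁺ˡ ∘ increasingLists-⊆ N≤N′
... | inj₂ refl       = id

firstN-∈-increasingLists : ∀ {n} → Increasing n → ∀ k → firstN n (suc k) ∈ increasingLists (suc (n k))
firstN-∈-increasingLists {n} inc k =
  subst (_∈ increasingLists (suc (n k))) (sym (firstN-suc n k)) (∈-++⁺ʳ _ (∈-map⁺ (_∷ʳ n k) (prefix k)))
  where
  prefix : ∀ k → firstN n k ∈ increasingLists (n k)
  prefix zero    = increasingLists-⊆ {N′ = n 0} z≤n (here refl)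
  prefix (suc k) = increasingLists-⊆ (inc k) (firstN-∈-increasingLists inc k)

module FromStrategyOfOne (lem : ExcludedMiddle 0ℓ) {F : Family} (filter : IsFilter F)
                         (nonPrincipal : NonPrincipal F) (σ : List ℕ → ℕ)
                         (σ-wins : ∀ n → ¬ TwoWinsPlay F (λ k → σ (firstN n k)) n) where

  maxσ : ℕ → ℕ
  maxσ N = max 0 (map σ (increasingLists N))

  σ≤maxσ : ∀ N {l} → l ∈ increasingLists N → σ l ≤ maxσ N
  σ≤maxσ N l∈ = All.lookup (xs≤max 0 _) (∈-map⁺ σ l∈)

  e : ℕ → ℕ
  e = partitionBy maxσ

  -- Enumerating a member of F that misses infinitely many intervals gives a play in which TWO
  -- jumps over each missed interval, and so over ONE's answer to any history below it.
  meets : ∀ x → F x → ¬ MissesInfinitelyMany e x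
  meets x x∈F missesInf = σ-wins n (increasing , infinitelyAbove , range∈F)
    where
    open Enumeration (enumerate lem x (λ finite → nonPrincipal x finite x∈F))

    range∈F : F (rangeInc n)
    range∈F = IsFilter.upward filter x (rangeInc n) complete x∈F

    infinitelyAbove : ∀ K → Σ ℕ λ k → K ≤ k × σ (firstN n k) < n k
    infinitelyAbove K
      with j , nK<j , misses ← missesInf (suc (n K))
      with k , K≤k , nk<ej , ej≤nk₁
             ← straddle increasing (<-≤-trans nK<j (increasing-inflationary (partitionBy-increasing maxσ) j))
      = suc k , m≤n⇒m≤1+n K≤k , <-≤-trans (s≤s σ≤) beyond
      where
      beyond : e (suc j) ≤ n (suc k)
      beyond = ≮⇒≥ λ lt → contradiction (trans (sym (n∈x (suc k))) (misses (n (suc k)) ej≤nk₁ lt)) λ ()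
      σ≤ : σ (firstN n (suc k)) ≤ e j + maxσ (e j)
      σ≤ = ≤-trans (σ≤maxσ (e j) (increasingLists-⊆ nk<ej (firstN-∈-increasingLists increasing k)))
                   (m≤n+m (maxσ (e j)) (e j))

talagrand-if-oneWins : ExcludedMiddle 0ℓ → ∀ {F} → IsFilter F → NonPrincipal F →
                       OneHasWinningStrategy F → TalagrandPartition F
talagrand-if-oneWins lem filter nonPrincipal (σ , σ-wins) = record
  { e          = e
  ; increasing = partitionBy-increasing maxσ
  ; meets      = meets
  }
  where open FromStrategyOfOne lem filter nonPrincipal σ σ-wins

-- From a Talagrand partition to a meager filter

MeetsFrom : (ℕ → ℕ) → ℕ → Family
MeetsFrom e J x = ∀ j → J ≤ j → ¬ Misses e x j

meetsFrom-nowhereDense : ∀ {e} → Increasing e → ∀ J → NowhereDense (MeetsFrom e J)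
meetsFrom-nowhereDense {e} inc J s = replicate (e (suc j)) false , λ x ext meets →
    meets j (m≤m+n J (length s)) λ i ej≤i i<ej₁ → zero-after-s x ext (s≤i ej≤i) i<ej₁
  where
  j = J + length s
  s≤i : ∀ {i} → e j ≤ i → length s ≤ i
  s≤i ej≤i = ≤-trans (m≤n+m (length s) J) (≤-trans (increasing-inflationary inc j) ej≤i)
  zero-after-s : ∀ x {i} → Extends (s ++ replicate (e (suc j)) false) x →
                 length s ≤ i → i < e (suc j) → x i ≡ false
  zero-after-s x {i} ext s≤i i<ej₁ = subst (λ k → x k ≡ false) (m+[n∸m]≡n s≤i)
    (Extends-replicate _ (Extends-++⁻ʳ s _ x ext) (≤-<-trans (m∸n≤m i (length s)) i<ej₁))

meager-if-talagrand : ExcludedMiddle 0ℓ → ∀ {F} → TalagrandPartition F → Meager F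
meager-if-talagrand lem {F} P = MeetsFrom e , meetsFrom-nowhereDense increasing , cover
  where
  open TalagrandPartition P

  cover : ∀ x → F x → Σ ℕ λ J → MeetsFrom e J x
  cover x x∈F with lem {Σ ℕ λ J → MeetsFrom e J x}
  ... | yes meetsFrom  = meetsFrom
  ... | no  ¬meetsFrom = ⊥-elim (meets x x∈F missed)
    where
    missed : MissesInfinitelyMany e x
    missed J with lem {Σ ℕ λ j → J ≤ j × Misses e x j}
    ... | yes missedFrom  = missedFrom
    ... | no  ¬missedFrom = ⊥-elim (¬meetsFrom (J , λ j J≤j misses → ¬missedFrom (j , J≤j , misses)))

module Limit (S : ℕ → List ℕ) (M : ℕ → ℕ) (R : ℕ → List ℕ)
             (step : ∀ i → S (suc i) ≡ S i ++ M i ∷ R i) where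

  S-⊑ : ∀ {i i′} → i ≤ i′ → S i ⊑ S i′
  S-⊑ = ⊑-chain λ i → M i ∷ R i , sym (step i)

  length-S-increasing : Increasing (length ∘ S)
  length-S-increasing i rewrite step i | length-++ (S i) {M i ∷ R i} = m<m+n (length (S i)) z<s

  play : ℕ → ℕ
  play k = nth 0 (S (suc k)) k

  play-agrees : ∀ {i k} → k < length (S i) → play k ≡ nth 0 (S i) k
  play-agrees {i} {k} k<S with ≤-total i (suc k)
  ... | inj₁ i≤1+k = nth-⊑ (S-⊑ i≤1+k) k<S
  ... | inj₂ 1+k≤i = sym (nth-⊑ (S-⊑ 1+k≤i) (increasing-inflationary length-S-increasing (suc k)))

  firstN-play : ∀ i → firstN play (length (S i)) ≡ S i
  firstN-play i = begin
    firstN play (length (S i))             ≡⟨ map-upTo play (length (S i)) ⟩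
    applyUpTo play (length (S i))          ≡⟨ applyUpTo-cong (length (S i)) play-agrees ⟩
    applyUpTo (nth 0 (S i)) (length (S i)) ≡⟨ applyUpTo-nth 0 (S i) ⟩
    S i                                    ∎
    where open ≡-Reasoning

  play-at-stage : ∀ i → play (length (S i)) ≡ M i
  play-at-stage i = begin
    play (length (S i))                     ≡⟨ play-agrees (length-S-increasing i) ⟩
    nth 0 (S (suc i)) (length (S i))        ≡⟨ cong (λ s → nth 0 s (length (S i))) (step i) ⟩
    nth 0 (S i ++ M i ∷ R i) (length (S i)) ≡⟨ nth-++-length (S i) (M i) (R i) ⟩
    M i                                     ∎
    where open ≡-Reasoning

  firstN-play-suc : ∀ i → firstN play (suc (length (S i))) ≡ S i ∷ʳ M i
  firstN-play-suc i = begin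
    firstN play (suc (length (S i)))                  ≡⟨ firstN-suc play (length (S i)) ⟩
    firstN play (length (S i)) ∷ʳ play (length (S i)) ≡⟨ cong₂ _∷ʳ_ (firstN-play i) (play-at-stage i) ⟩
    S i ∷ʳ M i                                        ∎
    where open ≡-Reasoning

  window : ∀ k → firstN play (suc k) ⊑ S 0 ⊎
           Σ ℕ λ i → (S i ∷ʳ M i) ⊑ firstN play (suc k) × firstN play (suc k) ⊑ S (suc i)
  window k with suc k ≤? length (S 0)
  ... | yes 1+k≤S₀ = inj₁ (subst (firstN play (suc k) ⊑_) (firstN-play 0) (firstN-⊑ play 1+k≤S₀))
  ... | no  1+k≰S₀ with i , _ , Si<1+k , 1+k≤Si₁ ← straddle length-S-increasing {0} (≰⇒> 1+k≰S₀) =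
    inj₂ (i , subst (_⊑ firstN play (suc k)) (firstN-play-suc i) (firstN-⊑ play Si<1+k)
            , subst (firstN play (suc k) ⊑_) (firstN-play (suc i)) (firstN-⊑ play 1+k≤Si₁))

-- TWO has no winning strategy

module AgainstStrategyOfTwo (lem : ExcludedMiddle 0ℓ) {F : Family} (filter : IsFilter F)
                            (nonPrincipal : NonPrincipal F) (τ : List ℕ → ℕ)
                            (τ-wins : ∀ m → TwoWinsPlay F m (λ k → τ (firstN m (suc k)))) where

  τ-mono : ∀ {p q} → 0 < length p → p ⊑ q → τ p ≤ τ q
  τ-mono {x ∷ p} _ (r , refl) = subst₂ (λ a b → τ a ≤ τ b)
      (firstN-nth (r , refl)) (firstN-nth (⊑-refl (x ∷ p ++ r)))
      (increasing-≤ (proj₁ (τ-wins (nth 0 (x ∷ p ++ r))))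
                    (subst (length p ≤_) (sym (length-++ p)) (m≤m+n _ _)))

  Jump : List ℕ → Set
  Jump q = ∀ M → M < τ (q ∷ʳ M)

  blocking-loses : ∀ q (c : List ℕ → ℕ) → ¬ (∀ r → τ ((q ++ r) ∷ʳ c r) ≤ c r)
  blocking-loses q c blocks = never-above (proj₁ (proj₂ (τ-wins play)) (length q))
    where
    R : ℕ → List ℕ
    R zero    = []
    R (suc i) = R i ∷ʳ c (R i)

    open Limit (λ i → q ++ R i) (c ∘ R) (λ _ → []) (λ i → sym (++-assoc q (R i) _))

    length-R : ∀ i → length (R i) ≡ i
    length-R zero    = refl
    length-R (suc i) = trans (length-++ (R i)) (trans (cong (_+ 1) (length-R i)) (+-comm i 1))

    blocked : ∀ i → τ (firstN play (suc (length (q ++ R i)))) ≤ play (length (q ++ R i))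
    blocked i rewrite firstN-play-suc i | play-at-stage i = blocks (R i)

    never-above : ¬ (Σ ℕ λ k → length q ≤ k × play k < τ (firstN play (suc k)))
    never-above (k , q≤k , above) =
      <⇒≱ above (subst (λ k → τ (firstN play (suc k)) ≤ play k) length-S (blocked i))
      where
      i = k ∸ length q
      length-S : length (q ++ R i) ≡ k
      length-S = trans (length-++ q) (trans (cong (length q +_) (length-R i)) (m+[n∸m]≡n q≤k))

  jump-extension : ∀ q → Σ (List ℕ) λ r → Jump (q ++ r)
  jump-extension q with lem {Σ (List ℕ) λ r → Jump (q ++ r)}
  ... | yes jumps = jumps
  ... | no ¬jumps = ⊥-elim (blocking-loses q (proj₁ ∘ blocker) (proj₂ ∘ blocker))
    where
    blocker : ∀ r → Σ ℕ λ M → τ ((q ++ r) ∷ʳ M) ≤ M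
    blocker r with lem {Σ ℕ λ M → τ ((q ++ r) ∷ʳ M) ≤ M}
    ... | yes blocks = blocks
    ... | no ¬blocks = ⊥-elim (¬jumps (r , λ M → ≰⇒> λ τ≤M → ¬blocks (M , τ≤M)))

  jump : List ℕ → List ℕ
  jump q = q ++ proj₁ (jump-extension q)

  jump-Jump : ∀ q → Jump (jump q)
  jump-Jump q = proj₂ (jump-extension q)

  module JumpPlay (S : ℕ → List ℕ) (M : ℕ → ℕ)
                  (S-Jump : ∀ i → Jump (S i)) (S-suc : ∀ i → S (suc i) ≡ jump (S i ∷ʳ M i)) where

    open Limit S M (λ i → proj₁ (jump-extension (S i ∷ʳ M i)))
               (λ i → trans (S-suc i) (∷ʳ-++ (S i) (M i) _)) public

    response : ℕ → ℕ
    response k = τ (firstN play (suc k))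

    τ-S-mono : ∀ {i i′} → i ≤ i′ → τ (S (suc i)) ≤ τ (S (suc i′))
    τ-S-mono {i} i≤i′ = τ-mono (≤-<-trans z≤n (length-S-increasing i)) (S-⊑ (s≤s i≤i′))

    response-bounds : ∀ k → response k ≤ τ (S 0) ⊎
                      Σ ℕ λ i → M i < response k × response k ≤ τ (S (suc i))
    response-bounds k with window k
    ... | inj₁ ⊑S₀ = inj₁ (τ-mono z<s ⊑S₀)
    ... | inj₂ (i , Si⊑ , ⊑Si₁) =
      inj₂ (i , <-≤-trans (S-Jump i (M i)) (τ-mono nonempty Si⊑) , τ-mono z<s ⊑Si₁)
      where
      nonempty : 0 < length (S i ∷ʳ M i)
      nonempty rewrite length-++ (S i) {M i ∷ []} = m≤n+m 1 (length (S i))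

  -- In each play ONE answers TWO's latest move in the other play, so TWO's moves in stage i of
  -- A lie in (τ (B i), τ (A (suc i))] and those in stage i of B in (τ (A (suc i)), τ (B (suc i))].
  mutual
    A : ℕ → List ℕ
    A zero    = jump []
    A (suc i) = jump (A i ∷ʳ τ (B i))

    B : ℕ → List ℕ
    B zero    = jump []
    B (suc i) = jump (B i ∷ʳ τ (A (suc i)))

  A-Jump : ∀ i → Jump (A i)
  A-Jump zero    = jump-Jump _
  A-Jump (suc i) = jump-Jump _

  B-Jump : ∀ i → Jump (B i)
  B-Jump zero    = jump-Jump _
  B-Jump (suc i) = jump-Jump _

  module PA = JumpPlay A (λ i → τ (B i)) A-Jump (λ _ → refl)
  module PB = JumpPlay B (λ i → τ (A (suc i))) B-Jump (λ _ → refl)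

  common-response-bounded : ∀ {k k′} → PA.response k ≡ PB.response k′ → PA.response k ≤ τ (jump [])
  common-response-bounded {k} {k′} eq with PA.response-bounds k | PB.response-bounds k′
  ... | inj₁ early | _          = early
  ... | inj₂ _     | inj₁ early = subst (_≤ τ (jump [])) (sym eq) early
  ... | inj₂ (i , lowA , highA) | inj₂ (i′ , lowB , highB) with ≤-total i i′
  ...   | inj₁ i≤i′ = ⊥-elim (<-irrefl eq (≤-<-trans (≤-trans highA (PA.τ-S-mono i≤i′)) lowB))
  ...   | inj₂ i′≤i with m≤n⇒m<n∨m≡n i′≤i
  ...     | inj₂ refl          = ⊥-elim (<-irrefl eq (≤-<-trans highA lowB))
  ...     | inj₁ (s≤s i′≤i-1) =
    ⊥-elim (<-irrefl (sym eq) (≤-<-trans (≤-trans highB (PB.τ-S-mono i′≤i-1)) lowA))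

  rangeA rangeB : Subset
  rangeA = rangeInc PA.response
  rangeB = rangeInc PB.response

  ranges-meet-finitely : Finite (rangeA ∩ rangeB)
  ranges-meet-finitely = suc (τ (jump [])) , bounded
    where
    bounded : ∀ j → (rangeA ∩ rangeB) j ≡ true → j < suc (τ (jump []))
    bounded j j∈
      with k , refl ← rangeInc-sound PA.response (∧-conicalˡ (rangeA j) (rangeB j) j∈)
      with k′ , eq ← rangeInc-sound PB.response (∧-conicalʳ (rangeA j) (rangeB j) j∈)
      = s≤s (common-response-bounded {k} {k′} (sym eq))

  absurd : ⊥
  absurd = nonPrincipal (rangeA ∩ rangeB) ranges-meet-finitely
    (IsFilter.inter filter rangeA rangeB (proj₂ (proj₂ (τ-wins PA.play))) (proj₂ (proj₂ (τ-wins PB.play))))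

twoCannotWin : ExcludedMiddle 0ℓ → ∀ {F} → IsFilter F → NonPrincipal F → ¬ TwoHasWinningStrategy F
twoCannotWin lem filter nonPrincipal (τ , τ-wins) = AgainstStrategyOfTwo.absurd lem filter nonPrincipal τ τ-wins

mainTheorem2 : ExcludedMiddle 0ℓ → (F : Family) → IsFilter F → NonPrincipal F →
    (Meager F ⇔ OneHasWinningStrategy F) × (OneHasWinningStrategy F ⇔ Determined F)
mainTheorem2 lem F filter nonPrincipal =
  mk⇔ (oneWins-if-talagrand ∘ talagrand-if-meager filter)
      (meager-if-talagrand lem ∘ talagrand-if-oneWins lem filter nonPrincipal) ,
  mk⇔ inj₁ [ id , ⊥-elim ∘ twoCannotWin lem filter nonPrincipal ]
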